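{- Let $t=\min\{t_m,t_{m+p}\}$. The factor $0^tm$ of $\mathbf u_\beta$ has exactly two left extensions, $0$ and a nonzero letter $z$, and $$z=\begin{cases}1+\max\{j: 0^j\text{ is a suffix of }t_{m+1}\cdots t_{m+p}t_{m+1}\cdots t_{m+p-1}\} & \text{if } t_m>t_{m+p},\\ 1+\max\{j: 0^j\text{ is a suffix of }t_1\cdots t_{m-1}\} & \text{if } t_{m+p}>t_m.\end{cases}$$
   Context: Let $\beta>1$ be a non-simple Parry number: its Rényi expansion of unity $d_\beta(1)=t_1t_2t_3\cdots$ (nonnegative integers with $t_1=\lfloor\beta\rfloor$, $1=\sum_{i\ge1}t_i\beta^{ -i}$, and $t_it_{i+1}\cdots\prec t_1t_2\cdots$ lexicographically for all $i\ge2$) has the form $t_1\cdots t_m(t_{m+1}\cdots t_{m+p})^\omega$ and is not of the form $t_1\cdots t_k0^\omega$, with $m,p\ge1$ least possible (so $t_m\neq t_{m+p}$). Assume $t_1\ge2$. On $\mathcal A=\{0,1,\dots,m+p-1\}$ let $\varphi$ be the substitution $\varphi(k)=0^{t_{k+1}}(k+1)$ for $0\le k\le m+p-2$, $\varphi(m+p-1)=0^{t_{m+p}}m$, and $\mathbf u_\beta=\lim_n\varphi^n(0)$ its fixed point. A left extension of a factor $w$ is a letter $x$ with $xw$ a factor of $\mathbf u_\beta$. Integers are identified with letters of $\mathcal A$. -}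

module Defs where

open import Data.Nat using (ℕ; zero; suc; _+_; _∸_; _≤_; _<_; _<ᵇ_)
open import Data.Bool using (if_then_else_)
open import Data.List using (List; []; _∷_; _++_; [_]; replicate; map; upTo; concatMap)
open import Data.Product using (Σ; ∃; _×_)
open import Relation.Binary.PropositionalEquality using (_≡_)
open import Relation.Nullary using (¬_)

-- Convention: a digit sequence is t : ℕ → ℕ, 0-INDEXED:  t i  stands for the
-- paper's  t_{i+1}.  So t_1 = t 0, t_m = t (m ∸ 1), t_{m+p} = t (m + p ∸ 1).

_≺_ : (ℕ → ℕ) → (ℕ → ℕ) → Set
s ≺ t = ∃ λ n → (∀ k → k < n → s k ≡ t k) × (s n < t n)

shift : ℕ → (ℕ → ℕ) → (ℕ → ℕ)
shift i t n = t (i + n)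

-- The finite word t_{a+1} t_{a+2} ... t_{a+len} (paper indexing).
segment : (ℕ → ℕ) → ℕ → ℕ → List ℕ
segment t a len = map (λ k → t (a + k)) (upTo len)

-- Hypotheses: t = t_1 ⋯ t_m (t_{m+1} ⋯ t_{m+p})^ω is the Rényi expansion
-- d_β(1) of a non-simple Parry number β, with m, p ≥ 1 least possible, t_1 ≥ 2.
-- By Parry's theorem, a sequence of nonnegative integers is d_β(1) for some
-- (unique) β > 1 iff σ^i(t) ≺ t for all i ≥ 1 (and t ≠ 0^ω, implied by t_1 ≥ 2).
record NonSimpleParry (t : ℕ → ℕ) (m p : ℕ) : Set where
  field
    m≥1        : 1 ≤ m
    p≥1        : 1 ≤ p
    t₁≥2       : 2 ≤ t 0
    admissible : ∀ i → 1 ≤ i → shift i t ≺ t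
    periodic   : ∀ i → m ≤ i → t (i + p) ≡ t i
    -- m least possible (equivalently t_m ≠ t_{m+p})
    m-least    : ¬ (t (m ∸ 1) ≡ t (m + p ∸ 1))
    p-least    : ∀ q → 1 ≤ q → q < p → ¬ (∀ i → m ≤ i → t (i + q) ≡ t i)
    nonSimple  : ∀ k → ¬ (∀ i → k ≤ i → t i ≡ 0)

-- The substitution φ on the alphabet {0,…,m+p-1}:
--   φ(k) = 0^{t_{k+1}} (k+1)  for k ≤ m+p-2,   φ(m+p-1) = 0^{t_{m+p}} m.
-- (Letters ≥ m+p never occur; their image is irrelevant.)
φ : (ℕ → ℕ) → ℕ → ℕ → ℕ → List ℕ
φ t m p k = replicate (t k) 0 ++ [ (if suc k <ᵇ m + p then suc k else m) ]

φ* : (ℕ → ℕ) → ℕ → ℕ → List ℕ → List ℕ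
φ* t m p = concatMap (φ t m p)

φ^ : (ℕ → ℕ) → ℕ → ℕ → ℕ → List ℕ → List ℕ
φ^ t m p zero    w = w
φ^ t m p (suc n) w = φ* t m p (φ^ t m p n w)

IsFactorOf : List ℕ → List ℕ → Set
IsFactorOf w v = ∃ λ xs → ∃ λ ys → xs ++ w ++ ys ≡ v

IsSuffixOf : List ℕ → List ℕ → Set
IsSuffixOf s v = ∃ λ xs → xs ++ s ≡ v

-- w is a factor of u_β = lim φ^n(0).  Since φ(0) starts with 0, the words
-- φ^n(0) are prefixes of u_β of unbounded length, so the factors of u_β are
-- exactly the factors of the words φ^n(0).
Factor : (ℕ → ℕ) → ℕ → ℕ → List ℕ → Set
Factor t m p w = ∃ λ n → IsFactorOf w (φ^ t m p n [ 0 ])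

LeftExt : (ℕ → ℕ) → ℕ → ℕ → ℕ → List ℕ → Set
LeftExt t m p x w = Factor t m p (x ∷ w)

IsMaxZeroSuffix : List ℕ → ℕ → Set
IsMaxZeroSuffix L j = IsSuffixOf (replicate j 0) L
                    × (∀ k → IsSuffixOf (replicate k 0) L → k ≤ j)

-- Every nonzero letter of u_β = φ(u_β) is the last letter of a block φ(k) = 0^{t_{k+1}} next(k), and the
-- blocks ending in m are those of m - 1 and m + p - 1.  So in an occurrence x 0^r m with r = min(t_m, t_{m+p})
-- either the block has more than r zeros and x = 0, or it has exactly r zeros and x = next(a) for a left
-- neighbour a of its letter; both cases occur.  Left neighbours of a nonzero letter b are found by walking
-- down: it is 0 if t_b > 0, and otherwise one more than a left neighbour of b - 1.  Hence a is unique and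
-- equals the number of trailing zeros of t_1 ⋯ t_{m-1}, resp. t_{m+1} ⋯ t_{m+p-1}: the walk cannot pass
-- the letter 0 since t_1 ≥ 2, nor the letter m since t_m > 0 and the period t_{m+1} ⋯ t_{m+p} is not all
-- zero (which also makes the paper's doubled period have the same trailing zeros).

module Submission where

open import Defs
open import Data.Nat using (ℕ; zero; suc; _+_; _*_; _∸_; _<_; _≤_; _⊓_; z≤n; s≤s; z<s; _<ᵇ_; NonZero)
open import Data.Nat.Properties
open import Data.Nat.DivMod using (_%_; _/_; m≡m%n+[m/n]*n; m%n<n)
open import Data.Bool using (true; false; if_then_else_; T)
open import Data.Unit using (tt)
open import Data.List using (List; []; _∷_; _++_; [_]; replicate; map; upTo; foldl; length; _∷ʳ_; initLast; _∷ʳ′_)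
open import Data.List.Properties
  using (++-assoc; ++-identityʳ; ++-cancelʳ; ++-conicalʳ; ∷ʳ-injective; ∷-injectiveˡ; ∷-injectiveʳ;
         concatMap-++; map-++; upTo-∷ʳ; foldl-∷ʳ; foldl-++; length-map; length-upTo)
open import Data.List.Relation.Unary.All using (All; []; _∷_)
import Data.List.Relation.Unary.All as All
open import Data.List.Relation.Unary.All.Properties using (++⁺; ++⁻ʳ; map⁻; replicate⁺)
open import Data.List.Membership.Propositional.Properties using (∈-upTo⁺)
open import Data.Product using (∃; _×_; _,_; proj₁; proj₂)
open import Data.Sum using (_⊎_; inj₁; inj₂)
open import Data.Empty using (⊥-elim)
open import Function.Bundles using (_⇔_; mk⇔)
open import Relation.Binary.PropositionalEquality hiding ([_])
open import Relation.Nullary using (¬_; Dec; yes; no; contradiction)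

replicate-+ : ∀ a b (x : ℕ) → replicate (a + b) x ≡ replicate a x ++ replicate b x
replicate-+ zero    b x = refl
replicate-+ (suc a) b x = cong (x ∷_) (replicate-+ a b x)

replicate-∷ʳ : ∀ n (x : ℕ) → replicate (suc n) x ≡ replicate n x ∷ʳ x
replicate-∷ʳ zero    x = refl
replicate-∷ʳ (suc n) x = cong (x ∷_) (replicate-∷ʳ n x)

++-replicate-∷ʳ : ∀ (P : List ℕ) n x → P ++ replicate (suc n) x ≡ (P ++ replicate n x) ∷ʳ x
++-replicate-∷ʳ P n x = trans (cong (P ++_) (replicate-∷ʳ n x)) (sym (++-assoc P (replicate n x) [ x ]))

++-replicate-cancelʳ : ∀ {Q P : List ℕ} {x} r R → r ≤ R →
  Q ++ replicate r x ≡ P ++ replicate R x → Q ≡ P ++ replicate (R ∸ r) x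
++-replicate-cancelʳ {Q} zero R _ e = trans (sym (++-identityʳ Q)) e
++-replicate-cancelʳ {Q} {P} {x} (suc r) (suc R) (s≤s r≤R) e =
  ++-replicate-cancelʳ r R r≤R
    (proj₁ (∷ʳ-injective _ _ (trans (sym (++-replicate-∷ʳ Q r x)) (trans e (++-replicate-∷ʳ P R x)))))

last-before-longer-zeros : ∀ {xs x P} r R → r < R →
  (xs ∷ʳ x) ++ replicate r 0 ≡ P ++ replicate R 0 → x ≡ 0
last-before-longer-zeros {xs} {x} {P} r R r<R e
  with R ∸ r | m<n⇒0<n∸m r<R | ++-replicate-cancelʳ r R (<⇒≤ r<R) e
... | suc d | _ | e′ = proj₂ (∷ʳ-injective xs (P ++ replicate d 0) (trans e′ (++-replicate-∷ʳ P d 0)))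

locate-nonzero : ∀ n s xs {y ys C} → y ≢ 0 → xs ++ y ∷ ys ≡ (replicate n 0 ∷ʳ s) ++ C →
  (xs ≡ replicate n 0 × y ≡ s) ⊎ ∃ λ xs′ → xs ≡ (replicate n 0 ∷ʳ s) ++ xs′ × xs′ ++ y ∷ ys ≡ C
locate-nonzero zero    s []       y≢0 eq = inj₁ (refl , ∷-injectiveˡ eq)
locate-nonzero zero    s (x ∷ xs) y≢0 eq = inj₂ (xs , cong (_∷ xs) (∷-injectiveˡ eq) , ∷-injectiveʳ eq)
locate-nonzero (suc n) s []       y≢0 eq = ⊥-elim (y≢0 (∷-injectiveˡ eq))
locate-nonzero (suc n) s (x ∷ xs) y≢0 eq with locate-nonzero n s xs y≢0 (∷-injectiveʳ eq)
... | inj₁ (xs≡ , y≡)        = inj₁ (cong₂ _∷_ (∷-injectiveˡ eq) xs≡ , y≡)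
... | inj₂ (xs′ , xs≡ , eq′) = inj₂ (xs′ , cong₂ _∷_ (∷-injectiveˡ eq) xs≡ , eq′)

IsFactorOf-trans : ∀ {u v w} → IsFactorOf u v → IsFactorOf v w → IsFactorOf u w
IsFactorOf-trans {u} {v} {w} (xs , ys , u⊆v) (xs′ , ys′ , v⊆w) = xs′ ++ xs , ys ++ ys′ , (begin
    (xs′ ++ xs) ++ u ++ ys ++ ys′  ≡⟨ ++-assoc xs′ xs _ ⟩
    xs′ ++ xs ++ u ++ ys ++ ys′    ≡⟨ cong (λ z → xs′ ++ xs ++ z) (sym (++-assoc u ys ys′)) ⟩
    xs′ ++ xs ++ (u ++ ys) ++ ys′  ≡⟨ cong (xs′ ++_) (sym (++-assoc xs (u ++ ys) ys′)) ⟩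
    xs′ ++ (xs ++ u ++ ys) ++ ys′  ≡⟨ cong (λ z → xs′ ++ z ++ ys′) u⊆v ⟩
    xs′ ++ v ++ ys′                ≡⟨ v⊆w ⟩
    w                              ∎)
  where open ≡-Reasoning

zeros-IsFactorOf : ∀ {r R} ys → r ≤ R → IsFactorOf (replicate r 0 ++ ys) (replicate R 0 ++ ys)
zeros-IsFactorOf {r} {R} ys r≤R = replicate (R ∸ r) 0 , [] , (begin
    replicate (R ∸ r) 0 ++ (replicate r 0 ++ ys) ++ []  ≡⟨ cong (replicate (R ∸ r) 0 ++_) (++-identityʳ _) ⟩
    replicate (R ∸ r) 0 ++ replicate r 0 ++ ys          ≡⟨ sym (++-assoc (replicate (R ∸ r) 0) _ ys) ⟩
    (replicate (R ∸ r) 0 ++ replicate r 0) ++ ys        ≡⟨ cong (_++ ys) (sym (replicate-+ (R ∸ r) r 0)) ⟩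
    replicate (R ∸ r + r) 0 ++ ys                       ≡⟨ cong (λ n → replicate n 0 ++ ys) (m∸n+n≡m r≤R) ⟩
    replicate R 0 ++ ys                                 ∎)
  where open ≡-Reasoning

IsSuffixOf-∷ʳ⁺ : ∀ {s L} x → IsSuffixOf s L → IsSuffixOf (s ∷ʳ x) (L ∷ʳ x)
IsSuffixOf-∷ʳ⁺ {s} x (xs , e) = xs , trans (sym (++-assoc xs s [ x ])) (cong (_∷ʳ x) e)

IsSuffixOf-∷ʳ⁻ : ∀ {s L x y} → IsSuffixOf (s ∷ʳ x) (L ∷ʳ y) → IsSuffixOf s L × x ≡ y
IsSuffixOf-∷ʳ⁻ {s} {L} (xs , e) with ∷ʳ-injective (xs ++ s) L (trans (++-assoc xs s _) e)
... | e₁ , e₂ = (xs , e₁) , e₂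

zeros-IsSuffixOf-∷ʳ⁻ : ∀ {k L x} → IsSuffixOf (replicate (suc k) 0) (L ∷ʳ x) →
  IsSuffixOf (replicate k 0) L × 0 ≡ x
zeros-IsSuffixOf-∷ʳ⁻ {k} {L} {x} suf =
  IsSuffixOf-∷ʳ⁻ (subst (λ s → IsSuffixOf s (L ∷ʳ x)) (replicate-∷ʳ k 0) suf)

zeroRun : ℕ → ℕ → ℕ
zeroRun n zero    = suc n
zeroRun n (suc _) = 0

trailingZeros : List ℕ → ℕ
trailingZeros = foldl zeroRun 0

IsMaxZeroSuffix-[] : IsMaxZeroSuffix [] 0
IsMaxZeroSuffix-[] = ([] , refl) , maximal
  where
  maximal : ∀ k → IsSuffixOf (replicate k 0) [] → k ≤ 0
  maximal zero    _        = z≤n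
  maximal (suc k) (xs , e) with () ← ++-conicalʳ xs _ e

IsMaxZeroSuffix-∷ʳ : ∀ {L j} → IsMaxZeroSuffix L j → ∀ x → IsMaxZeroSuffix (L ∷ʳ x) (zeroRun j x)
IsMaxZeroSuffix-∷ʳ {L} {j} (suffix , maximal) zero =
  subst (λ s → IsSuffixOf s (L ∷ʳ 0)) (sym (replicate-∷ʳ j 0)) (IsSuffixOf-∷ʳ⁺ 0 suffix) , maximal′
  where
  maximal′ : ∀ k → IsSuffixOf (replicate k 0) (L ∷ʳ 0) → k ≤ suc j
  maximal′ zero    _ = z≤n
  maximal′ (suc k) suf = s≤s (maximal k (proj₁ (zeros-IsSuffixOf-∷ʳ⁻ suf)))
IsMaxZeroSuffix-∷ʳ {L} _ (suc x) = (L ∷ʳ suc x , ++-identityʳ _) , maximal′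
  where
  maximal′ : ∀ k → IsSuffixOf (replicate k 0) (L ∷ʳ suc x) → k ≤ 0
  maximal′ zero    _ = z≤n
  maximal′ (suc k) suf with () ← proj₂ (zeros-IsSuffixOf-∷ʳ⁻ suf)

IsMaxZeroSuffix-foldl : ∀ {A j} → IsMaxZeroSuffix A j → ∀ B → IsMaxZeroSuffix (A ++ B) (foldl zeroRun j B)
IsMaxZeroSuffix-foldl {A} h []      = subst (λ L → IsMaxZeroSuffix L _) (sym (++-identityʳ A)) h
IsMaxZeroSuffix-foldl {A} h (x ∷ B) =
  subst (λ L → IsMaxZeroSuffix L _) (++-assoc A [ x ] B) (IsMaxZeroSuffix-foldl (IsMaxZeroSuffix-∷ʳ h x) B)

trailingZeros-IsMaxZeroSuffix : ∀ L → IsMaxZeroSuffix L (trailingZeros L)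
trailingZeros-IsMaxZeroSuffix = IsMaxZeroSuffix-foldl IsMaxZeroSuffix-[]

foldl-zeroRun-≤ : ∀ n xs → foldl zeroRun n xs ≤ n + length xs
foldl-zeroRun-≤ n []          = m≤m+n n 0
foldl-zeroRun-≤ n (zero ∷ xs) =
  subst (foldl zeroRun (suc n) xs ≤_) (sym (+-suc n (length xs))) (foldl-zeroRun-≤ (suc n) xs)
foldl-zeroRun-≤ n (suc _ ∷ xs) = ≤-trans (foldl-zeroRun-≤ 0 xs) (≤-trans (n≤1+n _) (m≤n+m _ n))

foldl-zeroRun-forgets : ∀ n n′ xs → foldl zeroRun n xs ≡ foldl zeroRun n′ xs ⊎ All (_≡ 0) xs
foldl-zeroRun-forgets n n′ []           = inj₂ []
foldl-zeroRun-forgets n n′ (suc _ ∷ xs) = inj₁ refl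
foldl-zeroRun-forgets n n′ (zero ∷ xs) with foldl-zeroRun-forgets (suc n) (suc n′) xs
... | inj₁ e    = inj₁ e
... | inj₂ zeros = inj₂ (refl ∷ zeros)

segment-suc : ∀ t c d → segment t c (suc d) ≡ segment t c d ∷ʳ t (c + d)
segment-suc t c d =
  trans (cong (map (λ k → t (c + k))) (sym (upTo-∷ʳ d))) (map-++ (λ k → t (c + k)) (upTo d) [ d ])

trailingZeros-segment-suc : ∀ t c d →
  trailingZeros (segment t c (suc d)) ≡ zeroRun (trailingZeros (segment t c d)) (t (c + d))
trailingZeros-segment-suc t c d =
  trans (cong trailingZeros (segment-suc t c d)) (foldl-∷ʳ zeroRun 0 (t (c + d)) (segment t c d))

trailingZeros-segment-zero : ∀ t c d → t (c + d) ≡ 0 →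
  trailingZeros (segment t c (suc d)) ≡ suc (trailingZeros (segment t c d))
trailingZeros-segment-zero t c d tcd≡0 =
  trans (trailingZeros-segment-suc t c d) (cong (zeroRun (trailingZeros (segment t c d))) tcd≡0)

trailingZeros-segment-nonzero : ∀ t c d → 0 < t (c + d) → trailingZeros (segment t c (suc d)) ≡ 0
trailingZeros-segment-nonzero t c d tcd>0 with t (c + d) | trailingZeros-segment-suc t c d
... | suc _ | e = e

trailingZeros-segment-≤ : ∀ t c d → trailingZeros (segment t c d) ≤ d
trailingZeros-segment-≤ t c d =
  subst (trailingZeros (segment t c d) ≤_) (trans (length-map _ (upTo d)) (length-upTo d))
        (foldl-zeroRun-≤ 0 (segment t c d))

All-segment⁻ : ∀ {P : ℕ → Set} t c d → All P (segment t c d) → ∀ i → i < d → P (t (c + i))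
All-segment⁻ t c d h i i<d = All.lookup (map⁻ h) (∈-upTo⁺ i<d)

All-segment-suc : ∀ {P : ℕ → Set} t c d → All P (segment t c d) → P (t (c + d)) → All P (segment t c (suc d))
All-segment-suc {P} t c d h x = subst (All P) (sym (segment-suc t c d)) (++⁺ h (x ∷ []))

periodic-+* : ∀ {t : ℕ → ℕ} {m p} → (∀ i → m ≤ i → t (i + p) ≡ t i) →
  ∀ q i → m ≤ i → t (i + q * p) ≡ t i
periodic-+* {t} per zero    i _   = cong t (+-identityʳ i)
periodic-+* {t} {m} {p} per (suc q) i m≤i = begin
  t (i + (p + q * p))  ≡⟨ cong t (trans (cong (i +_) (+-comm p (q * p))) (sym (+-assoc i (q * p) p))) ⟩
  t (i + q * p + p)    ≡⟨ per (i + q * p) (≤-trans m≤i (m≤m+n i (q * p))) ⟩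
  t (i + q * p)        ≡⟨ periodic-+* per q i m≤i ⟩
  t i                  ∎
  where open ≡-Reasoning

zero-period⇒zero-tail : ∀ {t : ℕ → ℕ} {m p} .{{_ : NonZero p}} → (∀ i → m ≤ i → t (i + p) ≡ t i) →
  All (_≡ 0) (segment t m p) → ∀ i → m ≤ i → t i ≡ 0
zero-period⇒zero-tail {t} {m} {p} per zeros i m≤i = begin
  t i              ≡⟨ cong t i≡m+r+q*p ⟩
  t (m + r + q * p) ≡⟨ periodic-+* per q (m + r) (m≤m+n m r) ⟩
  t (m + r)        ≡⟨ All-segment⁻ t m p zeros r (m%n<n (i ∸ m) p) ⟩
  0                ∎
  where
  open ≡-Reasoning
  r q : ℕ
  r = (i ∸ m) % p
  q = (i ∸ m) / p
  i≡m+r+q*p : i ≡ m + r + q * p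
  i≡m+r+q*p = trans (sym (m+[n∸m]≡n m≤i))
                    (trans (cong (m +_) (m≡m%n+[m/n]*n (i ∸ m) p)) (sym (+-assoc m r (q * p))))

module Substitution (t : ℕ → ℕ) (m′ p′ : ℕ) where

  m p top : ℕ
  m   = suc m′
  p   = suc p′
  top = m′ + p

  next : ℕ → ℕ
  next k = if suc k <ᵇ m + p then suc k else m

  data NextView (k : ℕ) : ℕ → Set where
    step : suc k < m + p → NextView k (suc k)
    wrap : m + p ≤ suc k → NextView k m

  nextView : ∀ k → NextView k (next k)
  nextView k with suc k <ᵇ m + p in eq
  ... | true  = step (<ᵇ⇒< (suc k) (m + p) (subst T (sym eq) tt))
  ... | false = wrap (≮⇒≥ λ lt → subst T eq (<⇒<ᵇ lt))

  next-suc : ∀ {k} → suc k < m + p → next k ≡ suc k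
  next-suc {k} lt with next k | nextView k
  ... | _ | step _  = refl
  ... | _ | wrap ge = ⊥-elim (<⇒≱ lt ge)

  next-< : ∀ k → next k < m + p
  next-< k with next k | nextView k
  ... | _ | step lt = lt
  ... | _ | wrap _  = m<m+n m z<s

  next≢0 : ∀ k → next k ≢ 0
  next≢0 k with next k | nextView k
  ... | _ | step _ = λ ()
  ... | _ | wrap _ = λ ()

  next-top : next top ≡ m
  next-top with next top | nextView top
  ... | _ | step lt = ⊥-elim (<-irrefl refl lt)
  ... | _ | wrap _  = refl

  next≡suc⇒ : ∀ {k j} → next k ≡ suc j → suc j ≢ m → k ≡ j
  next≡suc⇒ {k} e j≢m with next k | nextView k
  ... | _ | step _ = suc-injective e
  ... | _ | wrap _ = ⊥-elim (j≢m (sym e))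

  next≡m⇒ : ∀ {k} → k < m + p → next k ≡ m → k ≡ m′ ⊎ k ≡ top
  next≡m⇒ {k} k<m+p e with next k | nextView k
  ... | _ | step _  = inj₁ (suc-injective e)
  ... | _ | wrap ge = inj₂ (suc-injective (≤-antisym k<m+p ge))

  PreimagesOfM : ℕ → ℕ → Set
  PreimagesOfM k₁ k₂ = (k₁ ≡ m′ × k₂ ≡ top) ⊎ (k₁ ≡ top × k₂ ≡ m′)

  PreimagesOfM-sym : ∀ {k₁ k₂} → PreimagesOfM k₁ k₂ → PreimagesOfM k₂ k₁
  PreimagesOfM-sym (inj₁ (e₁ , e₂)) = inj₂ (e₂ , e₁)
  PreimagesOfM-sym (inj₂ (e₁ , e₂)) = inj₁ (e₂ , e₁)

  PreimagesOfM-next : ∀ {k₁ k₂} → PreimagesOfM k₁ k₂ → k₁ < m + p × next k₁ ≡ m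
  PreimagesOfM-next (inj₁ (refl , _)) = m≤m+n m p , next-suc (m<m+n m z<s)
  PreimagesOfM-next (inj₂ (refl , _)) = ≤-refl , next-top

  next≡m⇒PreimagesOfM : ∀ {k₁ k₂ k} → PreimagesOfM k₁ k₂ → k < m + p → next k ≡ m → k ≡ k₁ ⊎ k ≡ k₂
  next≡m⇒PreimagesOfM roles lt e with next≡m⇒ lt e | roles
  ... | inj₁ k≡m′  | inj₁ (refl , refl) = inj₁ k≡m′
  ... | inj₂ k≡top | inj₁ (refl , refl) = inj₂ k≡top
  ... | inj₁ k≡m′  | inj₂ (refl , refl) = inj₂ k≡m′
  ... | inj₂ k≡top | inj₂ (refl , refl) = inj₁ k≡top

  Φ : List ℕ → List ℕ
  Φ = φ* t m p

  U : ℕ → List ℕ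
  U n = φ^ t m p n [ 0 ]

  Φ-++ : ∀ xs ys → Φ (xs ++ ys) ≡ Φ xs ++ Φ ys
  Φ-++ = concatMap-++ (φ t m p)

  Φ-∷ʳ : ∀ ys k → Φ (ys ∷ʳ k) ≡ (Φ ys ++ replicate (t k) 0) ∷ʳ next k
  Φ-∷ʳ ys k = trans (Φ-++ ys [ k ])
    (trans (cong (Φ ys ++_) (++-identityʳ _)) (sym (++-assoc (Φ ys) (replicate (t k) 0) [ next k ])))

  Φ-letters : ∀ w → All (_< m + p) (Φ w)
  Φ-letters []      = []
  Φ-letters (k ∷ w) = ++⁺ (++⁺ (replicate⁺ (t k) z<s) (next-< k ∷ [])) (Φ-letters w)

  U-letters : ∀ n → All (_< m + p) (U n)
  U-letters zero    = z<s ∷ []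
  U-letters (suc n) = Φ-letters (U n)

  decode : ∀ w xs {y ys} → y ≢ 0 → xs ++ y ∷ ys ≡ Φ w →
    ∃ λ w₁ → ∃ λ k → ∃ λ w₂ → w ≡ w₁ ++ k ∷ w₂ × xs ≡ Φ w₁ ++ replicate (t k) 0 × y ≡ next k
  decode []      xs y≢0 eq = contradiction (++-conicalʳ xs _ eq) λ ()
  decode (k ∷ w) xs y≢0 eq with locate-nonzero (t k) (next k) xs y≢0 eq
  ... | inj₁ (xs≡ , y≡) = [] , k , w , refl , xs≡ , y≡
  ... | inj₂ (xs′ , xs≡ , eq′) with decode w xs′ y≢0 eq′
  ... | w₁ , k′ , w₂ , w≡ , xs′≡ , y≡ =
    k ∷ w₁ , k′ , w₂ , cong (k ∷_) w≡ ,
    trans xs≡ (trans (cong (φ t m p k ++_) xs′≡) (sym (++-assoc (φ t m p k) (Φ w₁) _))) , y≡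

  Φ-last : ∀ {xs x} w → xs ∷ʳ x ≡ Φ w → ∃ λ ys → ∃ λ k → w ≡ ys ∷ʳ k × x ≡ next k
  Φ-last {xs} {x} w e with initLast w
  ... | []       = contradiction (++-conicalʳ xs [ x ] e) λ ()
  ... | ys ∷ʳ′ k = ys , k , refl , proj₂ (∷ʳ-injective xs _ (trans e (Φ-∷ʳ ys k)))

  decode-run : ∀ n xs x r {y ys} → y ≢ 0 → xs ++ x ∷ replicate r 0 ++ y ∷ ys ≡ U (suc n) →
    ∃ λ k → k < m + p × y ≡ next k × (r < t k → x ≡ 0) ×
      (t k ≡ r → ∃ λ k′ → IsFactorOf (k′ ∷ k ∷ []) (U n) × x ≡ next k′)
  decode-run n xs x r {y} {ys} y≢0 eq
    with decode (U n) ((xs ∷ʳ x) ++ replicate r 0) y≢0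
           (trans (++-assoc (xs ∷ʳ x) (replicate r 0) (y ∷ ys)) (trans (++-assoc xs [ x ] _) eq))
  ... | w₁ , k , w₂ , U≡ , ≡zeros , y≡ = k , k<m+p , y≡ , longer , equal
    where
    k<m+p : k < m + p
    k<m+p = All.head (++⁻ʳ w₁ (subst (All (_< m + p)) U≡ (U-letters n)))
    longer : r < t k → x ≡ 0
    longer r<tk = last-before-longer-zeros r (t k) r<tk ≡zeros
    equal : t k ≡ r → ∃ λ k′ → IsFactorOf (k′ ∷ k ∷ []) (U n) × x ≡ next k′
    equal tk≡r with Φ-last w₁ (++-cancelʳ (replicate r 0) (xs ∷ʳ x) (Φ w₁)
                                (trans ≡zeros (cong (λ n → Φ w₁ ++ replicate n 0) tk≡r)))
    ... | ys′ , k′ , w₁≡ , x≡ =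
      k′ , (ys′ , w₂ , sym (trans U≡ (trans (cong (_++ k ∷ w₂) w₁≡) (++-assoc ys′ [ k′ ] (k ∷ w₂))))) , x≡

  -- Where a factor a b with b ≠ 0 can come from in φ(u_β): inside one block, or across two blocks.
  data Precedes : ℕ → ℕ → Set where
    within-block  : ∀ k → 0 < t k → Precedes 0 (next k)
    across-blocks : ∀ {a} k → t k ≡ 0 → Precedes a k → Precedes (next a) (next k)

  Precedes-≢0 : ∀ {a b} → Precedes a b → b ≢ 0
  Precedes-≢0 (within-block k _)    = next≢0 k
  Precedes-≢0 (across-blocks k _ _) = next≢0 k

  Precedes-< : ∀ {a b} → Precedes a b → b < m + p
  Precedes-< (within-block k _)      = next-< k
  Precedes-< (across-blocks k _ _) = next-< k

  pair⇒Precedes : 0 < t 0 → ∀ n {a b} → b ≢ 0 → IsFactorOf (a ∷ b ∷ []) (U n) → Precedes a b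
  pair⇒Precedes _ zero _ ([] , ys , eq) with () ← ∷-injectiveʳ eq
  pair⇒Precedes _ zero _ (_ ∷ xs , ys , eq) = contradiction (++-conicalʳ xs _ (∷-injectiveʳ eq)) λ ()
  pair⇒Precedes t₀>0 (suc n) {a} b≢0 (xs , ys , eq) with decode-run n xs a 0 b≢0 eq
  ... | k , _ , b≡ , longer , equal with t k in tk
  ... | suc _ = subst₂ Precedes (sym (longer z<s)) (sym b≡) (within-block k (subst (0 <_) (sym tk) z<s))
  ... | zero with equal refl
  ... | k′ , k′k , a≡ = subst₂ Precedes (sym a≡) (sym b≡) (across-blocks k tk (pair⇒Precedes t₀>0 n k≢0 k′k))
    where
    k≢0 : k ≢ 0
    k≢0 refl = <⇒≢ t₀>0 (sym tk)

  Factor-Φ : ∀ {v} → Factor t m p v → Factor t m p (Φ v)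
  Factor-Φ {v} (n , xs , ys , e) = suc n , Φ xs , Φ ys ,
    trans (sym (trans (Φ-++ xs (v ++ ys)) (cong (Φ xs ++_) (Φ-++ v ys)))) (cong Φ e)

  Factor-⊆ : ∀ {u v} → IsFactorOf u v → Factor t m p v → Factor t m p u
  Factor-⊆ u⊆v (n , v⊆U) = n , IsFactorOf-trans u⊆v v⊆U

  U-∷ʳ : ∀ k → k < m + p → ∃ λ Q → U k ≡ Q ∷ʳ k
  U-∷ʳ zero    _  = [] , refl
  U-∷ʳ (suc k) lt with U-∷ʳ k (<-trans (n<1+n k) lt)
  ... | Q , e = Φ Q ++ replicate (t k) 0 ,
                trans (cong Φ e) (trans (Φ-∷ʳ Q k) (cong ((Φ Q ++ replicate (t k) 0) ∷ʳ_) (next-suc lt)))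

  letter-occurs : ∀ k → k < m + p → Factor t m p [ k ]
  letter-occurs k lt with U-∷ʳ k lt
  ... | Q , e = k , Q , [] , sym e

  block-occurs : ∀ k → k < m + p → Factor t m p (replicate (t k) 0 ∷ʳ next k)
  block-occurs k lt = subst (Factor t m p) (++-identityʳ _) (Factor-Φ (letter-occurs k lt))

  zero-next : ∀ k → k < m + p → 0 < t k → Factor t m p (0 ∷ next k ∷ [])
  zero-next k lt tk>0 = Factor-⊆ (zeros-IsFactorOf [ next k ] tk>0) (block-occurs k lt)

  pair-image : ∀ {a b} → Factor t m p (a ∷ b ∷ []) → Factor t m p (next a ∷ replicate (t b) 0 ∷ʳ next b)
  pair-image {a} F =
    Factor-⊆ (replicate (t a) 0 , [] , sym (++-assoc (replicate (t a) 0) [ next a ] _)) (Factor-Φ F)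

  pair-image-zero : ∀ {a b} → Factor t m p (a ∷ b ∷ []) → t b ≡ 0 → Factor t m p (next a ∷ next b ∷ [])
  pair-image-zero {a} {b} F tb≡0 =
    subst (λ r → Factor t m p (next a ∷ replicate r 0 ∷ʳ next b)) tb≡0 (pair-image F)

  next-+ : ∀ c d → c + suc d < m + p → next (c + d) ≡ c + suc d
  next-+ c d lt = trans (next-suc (subst (_< m + p) (+-suc c d) lt)) (sym (+-suc c d))

  predecessor : ∀ {k} c d → next k ≡ c + suc d → (∀ i → i < suc d → suc (c + i) ≢ m) → k ≡ c + d
  predecessor c d next≡ avoids-m = next≡suc⇒ (trans next≡ (+-suc c d)) (avoids-m d (n<1+n d))

  next-trailingZeros : ∀ c d → suc d < m + p →
    next (trailingZeros (segment t c d)) ≡ suc (trailingZeros (segment t c d))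
  next-trailingZeros c d lt = next-suc (≤-<-trans (s≤s (trailingZeros-segment-≤ t c d)) lt)

  Precedes⇒trailingZeros : ∀ c d {a b} → Precedes a b → b ≡ c + d →
    (∀ i → i < d → suc (c + i) ≢ m) →
    (All (_≡ 0) (segment t c d) → ∀ {a′} → Precedes a′ c → a′ ≡ 0) →
    a ≡ trailingZeros (segment t c d)
  Precedes⇒trailingZeros c zero pr b≡ _ boundary =
    boundary [] (subst (Precedes _) (trans b≡ (+-identityʳ c)) pr)
  Precedes⇒trailingZeros c (suc d) (within-block k tk>0) b≡ avoids-m _ =
    sym (trailingZeros-segment-nonzero t c d (subst (λ i → 0 < t i) (predecessor c d b≡ avoids-m) tk>0))
  Precedes⇒trailingZeros c (suc d) (across-blocks {a′} k tk≡0 pr) b≡ avoids-m boundary = begin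
    next a′                                    ≡⟨ cong next IH ⟩
    next (trailingZeros (segment t c d))       ≡⟨ next-trailingZeros c d (≤-<-trans (m≤n+m (suc d) c) b<m+p) ⟩
    suc (trailingZeros (segment t c d))        ≡⟨ sym (trailingZeros-segment-zero t c d tcd≡0) ⟩
    trailingZeros (segment t c (suc d))        ∎
    where
    open ≡-Reasoning
    b<m+p : c + suc d < m + p
    b<m+p = subst (_< m + p) b≡ (next-< k)
    k≡c+d : k ≡ c + d
    k≡c+d = predecessor c d b≡ avoids-m
    tcd≡0 : t (c + d) ≡ 0
    tcd≡0 = trans (cong t (sym k≡c+d)) tk≡0
    IH : a′ ≡ trailingZeros (segment t c d)
    IH = Precedes⇒trailingZeros c d pr k≡c+d (λ i i<d → avoids-m i (m<n⇒m<1+n i<d))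
           (λ zeros → boundary (All-segment-suc t c d zeros tcd≡0))

  trailingZeros-leftOf : ∀ c d → c + d < m + p →
    (All (_≡ 0) (segment t c d) → Factor t m p (0 ∷ c ∷ [])) →
    Factor t m p (trailingZeros (segment t c d) ∷ c + d ∷ [])
  trailingZeros-leftOf c zero _ boundary =
    subst (λ b → Factor t m p (0 ∷ b ∷ [])) (sym (+-identityʳ c)) (boundary [])
  trailingZeros-leftOf c (suc d) lt boundary =
    subst (λ b → Factor t m p (trailingZeros (segment t c (suc d)) ∷ b ∷ [])) (next-+ c d lt)
          (by-last-digit (t (c + d) ≟ 0))
    where
    c+d<m+p : c + d < m + p
    c+d<m+p = <-trans (+-monoʳ-< c (n<1+n d)) lt
    by-last-digit : Dec (t (c + d) ≡ 0) →
      Factor t m p (trailingZeros (segment t c (suc d)) ∷ next (c + d) ∷ [])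
    by-last-digit (no tcd≢0) =
      subst (λ a → Factor t m p (a ∷ next (c + d) ∷ []))
            (sym (trailingZeros-segment-nonzero t c d (n≢0⇒n>0 tcd≢0)))
            (zero-next (c + d) c+d<m+p (n≢0⇒n>0 tcd≢0))
    by-last-digit (yes tcd≡0) =
      subst (λ a → Factor t m p (a ∷ next (c + d) ∷ []))
            (trans (next-trailingZeros c d (≤-<-trans (m≤n+m (suc d) c) lt))
                   (sym (trailingZeros-segment-zero t c d tcd≡0)))
            (pair-image-zero (trailingZeros-leftOf c d c+d<m+p (λ zeros → boundary (All-segment-suc t c d zeros tcd≡0)))
                             tcd≡0)

module LeftExtensions {t : ℕ → ℕ} {m′ p′ : ℕ} (H : NonSimpleParry t (suc m′) (suc p′)) where
  open NonSimpleParry H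
  open Substitution t m′ p′

  t₀>0 : 0 < t 0
  t₀>0 = ≤-trans (s≤s z≤n) t₁≥2

  t≤t₀ : ∀ i → 1 ≤ i → t i ≤ t 0
  t≤t₀ i 1≤i with admissible i 1≤i
  ... | zero  , _     , lt = <⇒≤ (subst (λ j → t j < t 0) (+-identityʳ i) lt)
  ... | suc _ , agree , _  = ≤-reflexive (trans (cong t (sym (+-identityʳ i))) (agree 0 z<s))

  period-not-zero : ¬ All (_≡ 0) (segment t m p)
  period-not-zero zeros = nonSimple m (zero-period⇒zero-tail periodic zeros)

  LeftExtensionsOf : ℕ → ℕ → Set
  LeftExtensionsOf r z = ∀ x → LeftExt t m p x (replicate r 0 ++ [ m ]) ⇔ (x ≡ 0 ⊎ x ≡ z)

  leftExtensions : ∀ {k₁ k₂ a} → PreimagesOfM k₁ k₂ → t k₁ < t k₂ → k₁ ≢ 0 →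
    (∀ {a′} → Precedes a′ k₁ → a′ ≡ a) → Factor t m p (a ∷ k₁ ∷ []) →
    LeftExtensionsOf (t k₁) (next a)
  leftExtensions {k₁} {k₂} {a} roles t₁<t₂ k₁≢0 unique ak₁ x = mk⇔ to from
    where
    k₁-ends-m : k₁ < m + p × next k₁ ≡ m
    k₁-ends-m = PreimagesOfM-next roles

    k₂-ends-m : k₂ < m + p × next k₂ ≡ m
    k₂-ends-m = PreimagesOfM-next (PreimagesOfM-sym roles)

    to : LeftExt t m p x (replicate (t k₁) 0 ++ [ m ]) → x ≡ 0 ⊎ x ≡ next a
    to (zero , [] , ys , eq) =
      contradiction (++-conicalʳ (replicate (t k₁) 0) (m ∷ ys)
                      (trans (sym (++-assoc (replicate (t k₁) 0) [ m ] ys)) (∷-injectiveʳ eq))) λ ()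
    to (zero , _ ∷ xs , ys , eq) = contradiction (++-conicalʳ xs _ (∷-injectiveʳ eq)) λ ()
    to (suc n , xs , ys , eq)
      with decode-run n xs x (t k₁) (λ ())
             (trans (cong (λ w → xs ++ x ∷ w) (sym (++-assoc (replicate (t k₁) 0) [ m ] ys))) eq)
    ... | k , k<m+p , m≡ , longer , equal with next≡m⇒PreimagesOfM roles k<m+p (sym m≡)
    ... | inj₂ refl = inj₁ (longer t₁<t₂)
    ... | inj₁ refl with equal refl
    ... | k′ , k′k₁ , x≡ = inj₂ (trans x≡ (cong next (unique (pair⇒Precedes t₀>0 n k₁≢0 k′k₁))))

    from : x ≡ 0 ⊎ x ≡ next a → LeftExt t m p x (replicate (t k₁) 0 ++ [ m ])
    from (inj₁ refl) =
      Factor-⊆ (zeros-IsFactorOf [ m ] t₁<t₂)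
        (subst (λ b → Factor t m p (replicate (t k₂) 0 ∷ʳ b)) (proj₂ k₂-ends-m)
               (block-occurs k₂ (proj₁ k₂-ends-m)))
    from (inj₂ refl) =
      subst (λ b → Factor t m p (next a ∷ replicate (t k₁) 0 ∷ʳ b)) (proj₂ k₁-ends-m) (pair-image ak₁)

  leftOf-top-unique : 0 < t m′ → ∀ {a} → Precedes a top → a ≡ trailingZeros (segment t m p′)
  leftOf-top-unique tm′>0 pr =
    Precedes⇒trailingZeros m p′ pr (+-suc m′ p′) (λ i _ → >⇒≢ (s≤s (m≤m+n m i)))
      (λ zeros pr′ → boundary zeros pr′ refl)
    where
    boundary : All (_≡ 0) (segment t m p′) → ∀ {a b} → Precedes a b → b ≡ m → a ≡ 0
    boundary _ (within-block _ _) _ = refl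
    boundary zeros (across-blocks k tk≡0 pr′) next≡m with next≡m⇒ (Precedes-< pr′) next≡m
    ... | inj₁ refl = contradiction tk≡0 (>⇒≢ tm′>0)
    ... | inj₂ refl =
      contradiction (All-segment-suc t m p′ zeros (trans (cong t (sym (+-suc m′ p′))) tk≡0)) period-not-zero

  leftOf-top-occurs : 0 < t m′ → Factor t m p (trailingZeros (segment t m p′) ∷ top ∷ [])
  leftOf-top-occurs tm′>0 =
    subst (λ b → Factor t m p (trailingZeros (segment t m p′) ∷ b ∷ [])) (sym (+-suc m′ p′))
      (trailingZeros-leftOf m p′ (+-monoʳ-< m (n<1+n p′))
        (λ _ → subst (λ b → Factor t m p (0 ∷ b ∷ [])) (next-suc (m<m+n m z<s))
                     (zero-next m′ (m≤m+n m p) tm′>0)))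

  leftOf-m′-unique : ∀ {a} → Precedes a m′ → a ≡ trailingZeros (segment t 0 m′)
  leftOf-m′-unique pr =
    Precedes⇒trailingZeros 0 m′ pr refl (λ i i<m′ e → <-irrefl (suc-injective e) i<m′)
      (λ _ pr′ → contradiction refl (Precedes-≢0 pr′))

  leftOf-m′-occurs : m′ ≢ 0 → Factor t m p (trailingZeros (segment t 0 m′) ∷ m′ ∷ [])
  leftOf-m′-occurs m′≢0 = trailingZeros-leftOf 0 m′ (m≤m+n m p)
    (λ zeros → contradiction (All-segment⁻ t 0 m′ zeros 0 (n≢0⇒n>0 m′≢0)) (>⇒≢ t₀>0))

  trailingZeros-period-++ : trailingZeros (segment t m p ++ segment t m p′) ≡ trailingZeros (segment t m p′)
  trailingZeros-period-++
    with foldl-zeroRun-forgets (trailingZeros (segment t m p)) 0 (segment t m p′)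
  ... | inj₁ e     = trans (foldl-++ zeroRun 0 (segment t m p) (segment t m p′)) e
  ... | inj₂ zeros =
    trans (foldl-++ zeroRun 0 (segment t m p) (segment t m p′))
          (cong (λ n → foldl zeroRun n (segment t m p′)) (trailingZeros-segment-nonzero t m p′ t[m+p′]>0))
    where
    t[m+p′]>0 : 0 < t (m + p′)
    t[m+p′]>0 = n≢0⇒n>0 λ e → period-not-zero (All-segment-suc t m p′ zeros e)

  leftExtensions-via-top : t top < t m′ →
    ∃ λ j → IsMaxZeroSuffix (segment t m p ++ segment t m p′) j × LeftExtensionsOf (t m′ ⊓ t top) (suc j)
  leftExtensions-via-top lt = j , trailingZeros-IsMaxZeroSuffix _ ,
    subst₂ LeftExtensionsOf (sym (m≥n⇒m⊓n≡n (<⇒≤ lt)))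
           (trans (next-trailingZeros m p′ (m<n+m p z<s)) (cong suc (sym trailingZeros-period-++)))
           (leftExtensions (inj₂ (refl , refl)) lt top≢0 (leftOf-top-unique tm′>0) (leftOf-top-occurs tm′>0))
    where
    j : ℕ
    j = trailingZeros (segment t m p ++ segment t m p′)
    tm′>0 : 0 < t m′
    tm′>0 = ≤-<-trans z≤n lt
    top≢0 : top ≢ 0
    top≢0 = >⇒≢ (≤-trans (s≤s z≤n) (m≤n+m p m′))

  leftExtensions-via-m′ : t m′ < t top →
    ∃ λ j → IsMaxZeroSuffix (segment t 0 m′) j × LeftExtensionsOf (t m′ ⊓ t top) (suc j)
  leftExtensions-via-m′ lt = trailingZeros (segment t 0 m′) , trailingZeros-IsMaxZeroSuffix _ ,
    subst₂ LeftExtensionsOf (sym (m≤n⇒m⊓n≡m (<⇒≤ lt))) (next-trailingZeros 0 m′ (m<m+n m z<s))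
           (leftExtensions (inj₁ (refl , refl)) lt m′≢0 leftOf-m′-unique (leftOf-m′-occurs m′≢0))
    where
    m′≢0 : m′ ≢ 0
    m′≢0 refl = <⇒≱ lt (t≤t₀ top (≤-trans (s≤s z≤n) (m≤n+m p 0)))

corollary4p3 : (t : ℕ → ℕ) (m p : ℕ) → NonSimpleParry t m p →
    (t (m + p ∸ 1) < t (m ∸ 1) →
      ∃ λ j → IsMaxZeroSuffix (segment t m p ++ segment t m (p ∸ 1)) j
        × (∀ x → LeftExt t m p x (replicate (t (m ∸ 1) ⊓ t (m + p ∸ 1)) 0 ++ [ m ])
                   ⇔ (x ≡ 0 ⊎ x ≡ suc j)))
    × (t (m ∸ 1) < t (m + p ∸ 1) →
      ∃ λ j → IsMaxZeroSuffix (segment t 0 (m ∸ 1)) j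
        × (∀ x → LeftExt t m p x (replicate (t (m ∸ 1) ⊓ t (m + p ∸ 1)) 0 ++ [ m ])
                   ⇔ (x ≡ 0 ⊎ x ≡ suc j)))
corollary4p3 t zero    _       H = contradiction (NonSimpleParry.m≥1 H) λ ()
corollary4p3 t (suc _) zero    H = contradiction (NonSimpleParry.p≥1 H) λ ()
corollary4p3 t (suc _) (suc _) H = leftExtensions-via-top , leftExtensions-via-m′
  where open LeftExtensions H
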